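{- Let $A=(A_1,\ldots,A_m)\in\mathbb{Z}^{n\times m}$ with $\mathrm{rank}(A)=n$. Run the following procedure on $A$: 1. Choose $n$ linearly independent columns of $A$ and let $B^{(1)}=B=(B_1,\ldots,B_n)\in\mathbb{Z}^{n\times n}$ be the matrix they form; let $C$ be the multiset of the remaining columns of $A$. 2. While $C\neq\emptyset$: choose any $c\in C$ and compute the solution $x\in\mathbb{Q}^n$ of $Bx=c$. If $x\in\mathbb{Z}^n$, remove $c$ from $C$. Otherwise (an "exchange step") choose an index $i$ with $\{x_i\}\neq 0$, replace $C$ by $(C\setminus\{c\})\cup\{B_i\}$, and replace the column $B_i$ by $c-\big(\sum_{j\neq i}B_j\lfloor x_j\rfloor + B_i\lceil x_i\rfloor\big)$. 3. Output $B$. Then, for any choices made, the procedure performs at most $\log_2|\det(B^{(1)})|$ exchange steps.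
   Context: For $z\in\mathbb{R}$, $\lfloor z\rfloor$ is the floor, $\{z\}=z-\lfloor z\rfloor$ the fractional part, and $\lceil z\rfloor=\lfloor z+1/2\rfloor$ the nearest integer. Standing assumption of the paper: $\mathrm{rank}(A)=n$. -}

module Defs where

open import Data.Nat using (ℕ; zero; suc)
open import Data.Integer as ℤ using (ℤ; +_)
open import Data.Rational as ℚ using (ℚ; 0ℚ; ½; floor; _/_)
open import Data.Fin using (Fin; zero; suc; punchIn; _≟_)
open import Data.Fin.Properties using (any?)
open import Data.List using (List; []; _∷_; _++_; map; filter)
open import Data.List using (allFin) public
open import Data.Product using (∃; Σ; _,_; _×_)
open import Relation.Nullary using (¬_; ¬?)
open import Relation.Nullary.Decidable using (does)
open import Data.Bool using (if_then_else_)
open import Relation.Binary.PropositionalEquality using (_≡_)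

-- Column vectors in ℤ^n, and n×n integer matrices given by their n columns:
-- B j is the j-th column B_j, and B j i is its i-th entry.
Vecℤ : ℕ → Set
Vecℤ n = Fin n → ℤ

Cols : ℕ → Set
Cols n = Fin n → Vecℤ n

sumℤ : ∀ n → (Fin n → ℤ) → ℤ
sumℤ zero    f = + 0
sumℤ (suc n) f = f zero ℤ.+ sumℤ n (λ j → f (suc j))

sumℚ : ∀ n → (Fin n → ℚ) → ℚ
sumℚ zero    f = 0ℚ
sumℚ (suc n) f = f zero ℚ.+ sumℚ n (λ j → f (suc j))

detM : ∀ n → (Fin n → Fin n → ℤ) → ℤ
detM zero    M = + 1
detM (suc n) M = go n M
  where
  sign : ∀ {k} → Fin k → ℤ
  sign zero          = + 1
  sign (suc zero)    = ℤ.- (+ 1)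
  sign (suc (suc j)) = sign j
  go : ∀ n → (Fin (suc n) → Fin (suc n) → ℤ) → ℤ
  go n M = sumℤ (suc n) (λ j →
    sign j ℤ.* M zero j ℤ.* detM n (λ r c → M (suc r) (punchIn j c)))

det : ∀ {n} → Cols n → ℤ
det {n} B = detM n (λ i j → B j i)

toℚ : ℤ → ℚ
toℚ z = z / 1

LinIndep : ∀ {n} → Cols n → Set
LinIndep {n} B =
  (λc : Fin n → ℚ) →
  (∀ i → sumℚ n (λ j → λc j ℚ.* toℚ (B j i)) ≡ 0ℚ) →
  ∀ j → λc j ≡ 0ℚ

Solves : ∀ {n} → Cols n → (Fin n → ℚ) → Vecℤ n → Set
Solves {n} B x c = ∀ i → sumℚ n (λ j → toℚ (B j i) ℚ.* x j) ≡ toℚ (c i)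

frac : ℚ → ℚ
frac q = q ℚ.- toℚ (floor q)

nearest : ℚ → ℤ
nearest q = floor (q ℚ.+ ½)

IsIntegral : ∀ {n} → (Fin n → ℚ) → Set
IsIntegral x = ∀ j → frac (x j) ≡ 0ℚ

newColumn : ∀ {n} → Cols n → Vecℤ n → (Fin n → ℚ) → Fin n → Vecℤ n
newColumn {n} B c x i r =
  c r ℤ.- sumℤ n (λ j → B j r ℤ.* (if does (j ≟ i) then nearest (x j) else floor (x j)))

replaceCol : ∀ {n} → Cols n → Fin n → Vecℤ n → Cols n
replaceCol B i v j = if does (j ≟ i) then v else B j

-- States of the procedure: current B and current multiset C (as a list;
-- the choice of an element c ∈ C is the choice of a splitting C = C₁ ++ c ∷ C₂).
record State (n : ℕ) : Set where
  constructor ⟨_,_⟩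
  field
    Bs : Cols n
    Cs : List (Vecℤ n)

data Step {n : ℕ} : State n → State n → ℕ → Set where
  keep : ∀ B C₁ c C₂ (x : Fin n → ℚ) →
    Solves B x c → IsIntegral x →
    Step ⟨ B , C₁ ++ c ∷ C₂ ⟩ ⟨ B , C₁ ++ C₂ ⟩ 0
  exchange : ∀ B C₁ c C₂ (x : Fin n → ℚ) (i : Fin n) →
    Solves B x c → ¬ (frac (x i) ≡ 0ℚ) →
    Step ⟨ B , C₁ ++ c ∷ C₂ ⟩
         ⟨ replaceCol B i (newColumn B c x i) , (C₁ ++ C₂) ++ B i ∷ [] ⟩ 1

data Run {n : ℕ} : State n → State n → ℕ → Set where
  done : ∀ s → Run s s 0
  step : ∀ {s t u e k} → Step s t e → Run t u k → Run s u (e Data.Nat.+ k)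

remaining : ∀ {n m} → (Fin m → Vecℤ n) → (Fin n → Fin m) → List (Vecℤ n)
remaining {n} {m} A σ = map A (filter (λ k → ¬? (any? (λ j → σ j ≟ k))) (allFin m))

{-# OPTIONS --safe #-}
-- Over ℚ the new column of an exchange step is B y, where y = x − z is the vector of rounding errors
-- (z_j = ⌊x_j⌋ for j ≠ i and z_i = ⌈x_i⌋). Since the determinant is multilinear and alternating in the
-- columns, the step multiplies det B by y_i, and 0 < |y_i| ≤ 1/2 because {x_i} ≠ 0. Steps that keep B
-- do not change it. Independence of the initial columns makes det B⁽¹⁾ ≠ 0, so after k exchange steps
-- 1 ≤ |det B| ≤ 2⁻ᵏ |det B⁽¹⁾|, i.e. 2ᵏ ≤ |det B⁽¹⁾|.
module Submission where

open import Defs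
open import Data.Nat using (ℕ; _≤_)
open import Data.Nat.Logarithm using (⌊log₂_⌋; ⌊log₂⌋-mono-≤; ⌊log₂[2^n]⌋≡n)
open import Data.Integer using (∣_∣)
open import Data.Fin using (Fin)
open import Relation.Binary.PropositionalEquality using (_≡_)

open import Algebra.Bundles using (CommutativeRing)
open import Data.Bool using (if_then_else_)
open import Data.Empty using (⊥-elim)
open import Data.Fin using (zero; suc; punchIn; punchOut; toℕ; inject₁; _≟_)
open import Data.Fin.Properties
  using (punchIn-injective; punchInᵢ≢i; punchIn-punchOut; suc-injective; toℕ-injective; toℕ-inject₁; all?; ¬∀⟶∃¬)
open import Data.Nat as ℕ using (zero; suc)
import Data.Nat.Coprimality as Coprimality
open import Data.Integer as ℤ using (ℤ)
import Data.Integer.Properties as ℤP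
open import Data.Integer.DivMod using (_/_; _%_; a≡a%n+[a/n]*n; [n/d]*d≤n; n%d<d)
import Data.Nat.Properties as ℕP
open import Data.Nat.Induction using (<-rec)
open import Data.Product using (Σ-syntax; _×_; _,_; proj₁; proj₂)
open import Data.Rational as ℚ using (ℚ; mkℚ; 0ℚ; 1ℚ; ½; _+_; _*_; -_; _-_; 1/_)
import Data.Rational.Properties as ℚP
open import Data.Rational.Solver using (module +-*-Solver)
open import Data.Sum using (_⊎_; inj₁; inj₂)
open import Data.Vec.Functional using (removeAt; insertAt)
open import Data.Vec.Functional.Properties using (insertAt-lookup; insertAt-punchIn)
open import Relation.Binary using (tri<; tri≈; tri>)
open import Relation.Nullary using (¬_; yes; no; does)
open import Relation.Nullary.Decidable using (dec-true; dec-false)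
open import Relation.Binary.PropositionalEquality
  using (refl; sym; trans; cong; cong₂; subst; subst₂; _≢_; module ≡-Reasoning)
open import Algebra.Properties.Semiring.Sum (CommutativeRing.semiring ℚP.+-*-commutativeRing)
  using (sum; sum-cong-≗; sum-replicate-zero; sum-remove; ∑-distrib-+; *-distribˡ-sum)
open import Algebra.Properties.Group ℚP.+-0-group using (inverseʳ-unique; ⁻¹-involutive)

open ≡-Reasoning
open +-*-Solver using (solve; _:+_; _:*_; :-_; _:-_; _:=_; con)

select-≡ : ∀ {n} {A : Set} (i j : Fin n) {x y : A} → i ≡ j → (if does (i ≟ j) then x else y) ≡ x
select-≡ i j {x} {y} i≡j = cong (if_then x else y) (dec-true (i ≟ j) i≡j)

select-≢ : ∀ {n} {A : Set} (i j : Fin n) {x y : A} → i ≢ j → (if does (i ≟ j) then x else y) ≡ y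
select-≢ i j {x} {y} i≢j = cong (if_then x else y) (dec-false (i ≟ j) i≢j)

*≡0⇒≡0 : ∀ x y → x * y ≡ 0ℚ → y ≢ 0ℚ → x ≡ 0ℚ
*≡0⇒≡0 x y xy≡0 y≢0 = begin
  x                  ≡⟨ sym (ℚP.*-identityʳ x) ⟩
  x * 1ℚ             ≡⟨ cong (x *_) (sym (ℚP.*-inverseʳ y {{ℚ.≢-nonZero y≢0}})) ⟩
  x * (y * y⁻¹)      ≡⟨ sym (ℚP.*-assoc x y y⁻¹) ⟩
  x * y * y⁻¹        ≡⟨ cong (_* y⁻¹) xy≡0 ⟩
  0ℚ * y⁻¹           ≡⟨ ℚP.*-zeroˡ y⁻¹ ⟩
  0ℚ                 ∎
  where
  y⁻¹ = (1/ y) {{ℚ.≢-nonZero y≢0}}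

*-≢0 : ∀ {x y} → x ≢ 0ℚ → y ≢ 0ℚ → x * y ≢ 0ℚ
*-≢0 {x} {y} x≢0 y≢0 xy≡0 = x≢0 (*≡0⇒≡0 x y xy≡0 y≢0)

sumℚ≡sum : ∀ n (f : Fin n → ℚ) → sumℚ n f ≡ sum f
sumℚ≡sum zero    f = refl
sumℚ≡sum (suc n) f = cong (f zero +_) (sumℚ≡sum n (λ j → f (suc j)))

sum-zero : ∀ {n} {f : Fin n → ℚ} → (∀ j → f j ≡ 0ℚ) → sum f ≡ 0ℚ
sum-zero {n} f≡0 = trans (sum-cong-≗ f≡0) (sum-replicate-zero n)

sum-single : ∀ {n} (a : Fin n) {f : Fin n → ℚ} → (∀ j → j ≢ a → f j ≡ 0ℚ) → sum f ≡ f a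
sum-single {suc n} a {f} f≡0 = begin
  sum f                   ≡⟨ sum-remove {i = a} f ⟩
  f a + sum (removeAt f a) ≡⟨ cong (f a +_) (sum-zero (λ c → f≡0 (punchIn a c) (punchInᵢ≢i a c))) ⟩
  f a + 0ℚ                ≡⟨ ℚP.+-identityʳ (f a) ⟩
  f a                     ∎

sum-pair : ∀ {n} {a b : Fin n} {f : Fin n → ℚ} → a ≢ b →
  (∀ j → j ≢ a → j ≢ b → f j ≡ 0ℚ) → sum f ≡ f a + f b
sum-pair {suc n} {a} {b} {f} a≢b f≡0 = begin
  sum f                                ≡⟨ sum-remove {i = a} f ⟩
  f a + sum (removeAt f a)              ≡⟨ cong (f a +_) (sum-single (punchOut a≢b) rest≡0) ⟩
  f a + f (punchIn a (punchOut a≢b))    ≡⟨ cong (λ j → f a + f j) (punchIn-punchOut a≢b) ⟩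
  f a + f b                            ∎
  where
  rest≡0 : ∀ c → c ≢ punchOut a≢b → f (punchIn a c) ≡ 0ℚ
  rest≡0 c c≢b = f≡0 (punchIn a c) (punchInᵢ≢i a c)
    (λ eq → c≢b (punchIn-injective a c _ (trans eq (sym (punchIn-punchOut a≢b)))))

sum-sub-scaled : ∀ {n} (f g : Fin n → ℚ) k → sum (λ j → f j - k * g j) ≡ sum f - k * sum g
sum-sub-scaled f g k = begin
  sum (λ j → f j - k * g j)                 ≡⟨ sum-cong-≗ (λ j → solve 3 (λ f g k → f :- k :* g := f :+ (:- k) :* g) refl (f j) (g j) k) ⟩
  sum (λ j → f j + (- k) * g j)             ≡⟨ ∑-distrib-+ f (λ j → (- k) * g j) ⟩
  sum f + sum (λ j → (- k) * g j)           ≡⟨ cong (sum f +_) (sym (*-distribˡ-sum (- k) g)) ⟩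
  sum f + (- k) * sum g                     ≡⟨ solve 3 (λ s t k → s :+ (:- k) :* t := s :- k :* t) refl (sum f) (sum g) k ⟩
  sum f - k * sum g                         ∎

infix 7 _∙_
_∙_ : ∀ {m} → (Fin m → ℚ) → (Fin m → ℚ) → ℚ
v ∙ y = sum (λ j → v j * y j)

_*ᵥ_ : ∀ {k m} → (Fin k → Fin m → ℚ) → (Fin m → ℚ) → Fin k → ℚ
(M *ᵥ y) r = M r ∙ y

∙-insertAt : ∀ {m} (v : Fin (suc m) → ℚ) y a x → v ∙ insertAt y a x ≡ v a * x + removeAt v a ∙ y
∙-insertAt v y a x = begin
  v ∙ insertAt y a x                                             ≡⟨ sum-remove {i = a} (λ j → v j * insertAt y a x j) ⟩
  v a * insertAt y a x a + sum (λ c → v (punchIn a c) * insertAt y a x (punchIn a c))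
    ≡⟨ cong₂ (λ p q → v a * p + q) (insertAt-lookup y a x) (sum-cong-≗ (λ c → cong (v (punchIn a c) *_) (insertAt-punchIn y a x c))) ⟩
  v a * x + removeAt v a ∙ y                                     ∎

∙-sub-scaledʳ : ∀ {m} (v y z : Fin m → ℚ) k → v ∙ (λ j → y j - k * z j) ≡ v ∙ y - k * (v ∙ z)
∙-sub-scaledʳ v y z k = trans
  (sum-cong-≗ (λ j → solve 4 (λ v y z k → v :* (y :- k :* z) := v :* y :- k :* (v :* z)) refl (v j) (y j) (z j) k))
  (sum-sub-scaled (λ j → v j * y j) (λ j → v j * z j) k)

∙-subʳ : ∀ {m} (v y z : Fin m → ℚ) → v ∙ (λ j → y j - z j) ≡ v ∙ y - v ∙ z
∙-subʳ v y z = begin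
  v ∙ (λ j → y j - z j)         ≡⟨ sum-cong-≗ (λ j → cong (λ w → v j * (y j - w)) (sym (ℚP.*-identityˡ (z j)))) ⟩
  v ∙ (λ j → y j - 1ℚ * z j)    ≡⟨ ∙-sub-scaledʳ v y z 1ℚ ⟩
  v ∙ y - 1ℚ * (v ∙ z)          ≡⟨ cong (λ w → v ∙ y - w) (ℚP.*-identityˡ (v ∙ z)) ⟩
  v ∙ y - v ∙ z                 ∎

∙-sub-scaledˡ : ∀ {m} (u w y : Fin m → ℚ) k → (λ j → u j - k * w j) ∙ y ≡ u ∙ y - k * (w ∙ y)
∙-sub-scaledˡ u w y k = trans
  (sum-cong-≗ (λ j → solve 4 (λ u w y k → (u :- k :* w) :* y := u :* y :- k :* (w :* y)) refl (u j) (w j) (y j) k))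
  (sum-sub-scaled (λ j → u j * y j) (λ j → w j * y j) k)

∙-zeroˡ : ∀ {m} {v : Fin m → ℚ} y → (∀ j → v j ≡ 0ℚ) → v ∙ y ≡ 0ℚ
∙-zeroˡ y v≡0 = sum-zero (λ j → trans (cong (_* y j) (v≡0 j)) (ℚP.*-zeroˡ (y j)))

-- Determinants over ℚ

Matrix : ℕ → Set
Matrix n = Fin n → Fin n → ℚ

minor : ∀ {n} {A : Set} → (Fin (suc n) → Fin (suc n) → A) → Fin (suc n) → Fin n → Fin n → A
minor M j r = removeAt (M (suc r)) j

sgn : ∀ {n} → Fin n → ℚ
sgn zero    = 1ℚ
sgn (suc j) = - sgn j

sgn≢0 : ∀ {n} (j : Fin n) → sgn j ≢ 0ℚ
sgn≢0 zero    = ℚP.1≢0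
sgn≢0 (suc j) = λ -s≡0 → sgn≢0 j (ℚP.neg-injective -s≡0)

detℚ : ∀ n → Matrix n → ℚ
detℚ zero    M = 1ℚ
detℚ (suc n) M = sum (λ j → sgn j * M zero j * detℚ n (minor M j))

detℚ-cong : ∀ n {M N : Matrix n} → (∀ r c → M r c ≡ N r c) → detℚ n M ≡ detℚ n N
detℚ-cong zero    M≡N = refl
detℚ-cong (suc n) M≡N = sum-cong-≗ (λ j →
  cong₂ (λ x d → sgn j * x * d) (M≡N zero j) (detℚ-cong n (λ r c → M≡N (suc r) (punchIn j c))))

detℚ-linear : ∀ n (M U V : Matrix n) a k →
  (∀ r c → c ≢ a → M r c ≡ U r c) → (∀ r c → c ≢ a → M r c ≡ V r c) →
  (∀ r → M r a ≡ k * U r a + V r a) → detℚ n M ≡ k * detℚ n U + detℚ n V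
detℚ-linear (suc n) M U V a k M≡U M≡V Mₐ = begin
  detℚ (suc n) M                         ≡⟨ sum-cong-≗ term-linear ⟩
  sum (λ j → k * term U j + term V j)     ≡⟨ ∑-distrib-+ (λ j → k * term U j) (term V) ⟩
  sum (λ j → k * term U j) + sum (term V) ≡⟨ cong (_+ sum (term V)) (sym (*-distribˡ-sum k (term U))) ⟩
  k * detℚ (suc n) U + detℚ (suc n) V     ∎
  where
  term : Matrix (suc n) → Fin (suc n) → ℚ
  term X j = sgn j * X zero j * detℚ n (minor X j)
  term-linear : ∀ j → term M j ≡ k * term U j + term V j
  term-linear j with j ≟ a
  ... | yes refl = begin
    sgn j * M zero j * detℚ n (minor M j)
      ≡⟨ cong₂ (λ x d → sgn j * x * d) (Mₐ zero) (detℚ-cong n minorM≡minorU) ⟩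
    sgn j * (k * U zero j + V zero j) * detℚ n (minor U j)
      ≡⟨ solve 5 (λ s k u v d → s :* (k :* u :+ v) :* d := k :* (s :* u :* d) :+ s :* v :* d) refl (sgn j) k (U zero j) (V zero j) _ ⟩
    k * term U j + sgn j * V zero j * detℚ n (minor U j)
      ≡⟨ cong (λ d → k * term U j + sgn j * V zero j * d) (detℚ-cong n (λ r c → trans (sym (minorM≡minorU r c)) (M≡V (suc r) (punchIn j c) (punchInᵢ≢i j c)))) ⟩
    k * term U j + term V j ∎
    where
    minorM≡minorU : ∀ r c → minor M j r c ≡ minor U j r c
    minorM≡minorU r c = M≡U (suc r) (punchIn j c) (punchInᵢ≢i j c)
  ... | no j≢a = begin
    sgn j * M zero j * detℚ n (minor M j)
      ≡⟨ cong (sgn j * M zero j *_) minor-linear ⟩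
    sgn j * M zero j * (k * detℚ n (minor U j) + detℚ n (minor V j))
      ≡⟨ solve 5 (λ s m k d e → s :* m :* (k :* d :+ e) := k :* (s :* m :* d) :+ s :* m :* e) refl (sgn j) (M zero j) k _ _ ⟩
    k * (sgn j * M zero j * detℚ n (minor U j)) + sgn j * M zero j * detℚ n (minor V j)
      ≡⟨ cong₂ (λ u v → k * (sgn j * u * detℚ n (minor U j)) + sgn j * v * detℚ n (minor V j)) (M≡U zero j j≢a) (M≡V zero j j≢a) ⟩
    k * term U j + term V j ∎
    where
    a′ = punchOut j≢a
    off : ∀ c → c ≢ a′ → punchIn j c ≢ a
    off c c≢a′ eq = c≢a′ (punchIn-injective j c a′ (trans eq (sym (punchIn-punchOut j≢a))))
    minor-linear : detℚ n (minor M j) ≡ k * detℚ n (minor U j) + detℚ n (minor V j)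
    minor-linear = detℚ-linear n (minor M j) (minor U j) (minor V j) a′ k
      (λ r c c≢a′ → M≡U (suc r) (punchIn j c) (off c c≢a′))
      (λ r c c≢a′ → M≡V (suc r) (punchIn j c) (off c c≢a′))
      (λ r → subst (λ c → M (suc r) c ≡ k * U (suc r) c + V (suc r) c) (sym (punchIn-punchOut j≢a)) (Mₐ (suc r)))

detℚ-zero-column : ∀ n (M : Matrix n) a → (∀ r → M r a ≡ 0ℚ) → detℚ n M ≡ 0ℚ
detℚ-zero-column (suc n) M a M≡0 = sum-zero term≡0
  where
  term≡0 : ∀ j → sgn j * M zero j * detℚ n (minor M j) ≡ 0ℚ
  term≡0 j with j ≟ a
  ... | yes refl = begin
    sgn j * M zero j * detℚ n (minor M j) ≡⟨ cong (λ x → sgn j * x * detℚ n (minor M j)) (M≡0 zero) ⟩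
    sgn j * 0ℚ * detℚ n (minor M j)      ≡⟨ cong (_* detℚ n (minor M j)) (ℚP.*-zeroʳ (sgn j)) ⟩
    0ℚ * detℚ n (minor M j)              ≡⟨ ℚP.*-zeroˡ (detℚ n (minor M j)) ⟩
    0ℚ                                   ∎
  ... | no j≢a = begin
    sgn j * M zero j * detℚ n (minor M j) ≡⟨ cong (sgn j * M zero j *_) (detℚ-zero-column n (minor M j) (punchOut j≢a)
                                              (λ r → trans (cong (M (suc r)) (punchIn-punchOut j≢a)) (M≡0 (suc r)))) ⟩
    sgn j * M zero j * 0ℚ                ≡⟨ ℚP.*-zeroʳ (sgn j * M zero j) ⟩
    0ℚ                                   ∎

data Adjacent : ∀ {n} → Fin n → Fin n → Set where
  zero-one : ∀ {n} → Adjacent {suc (suc n)} zero (suc zero)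
  suc-suc  : ∀ {n} {p q : Fin n} → Adjacent p q → Adjacent (suc p) (suc q)

Adjacent⇒≢ : ∀ {n} {p q : Fin n} → Adjacent p q → p ≢ q
Adjacent⇒≢ zero-one    ()
Adjacent⇒≢ (suc-suc a) eq = Adjacent⇒≢ a (suc-injective eq)

inject₁-adjacent : ∀ {n} (i : Fin n) → Adjacent (inject₁ i) (suc i)
inject₁-adjacent {suc n} zero    = zero-one
inject₁-adjacent         (suc i) = suc-suc (inject₁-adjacent i)

sgn-adjacent : ∀ {n} {p q : Fin n} → Adjacent p q → sgn q ≡ - sgn p
sgn-adjacent zero-one    = refl
sgn-adjacent (suc-suc a) = cong -_ (sgn-adjacent a)

punchOut-adjacent : ∀ {n} {p q j : Fin (suc n)} → Adjacent p q → (j≢p : j ≢ p) (j≢q : j ≢ q) →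
  Adjacent (punchOut j≢p) (punchOut j≢q)
punchOut-adjacent {j = zero}               zero-one    j≢p j≢q = ⊥-elim (j≢p refl)
punchOut-adjacent {j = suc zero}           zero-one    j≢p j≢q = ⊥-elim (j≢q refl)
punchOut-adjacent {suc (suc n)} {j = suc (suc j)} zero-one j≢p j≢q = zero-one
punchOut-adjacent {j = zero}               (suc-suc a) j≢p j≢q = a
punchOut-adjacent {suc n} {j = suc j}      (suc-suc a) j≢p j≢q =
  suc-suc (punchOut-adjacent a (λ eq → j≢p (cong suc eq)) (λ eq → j≢q (cong suc eq)))

punchIn-adjacent : ∀ {n} {p q : Fin (suc n)} → Adjacent p q → ∀ c →
  punchIn p c ≡ punchIn q c ⊎ (punchIn p c ≡ q × punchIn q c ≡ p)
punchIn-adjacent zero-one    zero    = inj₂ (refl , refl)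
punchIn-adjacent zero-one    (suc c) = inj₁ refl
punchIn-adjacent (suc-suc a) zero    = inj₁ refl
punchIn-adjacent {suc n} (suc-suc a) (suc c) with punchIn-adjacent a c
... | inj₁ eq          = inj₁ (cong suc eq)
... | inj₂ (eq₁ , eq₂) = inj₂ (cong suc eq₁ , cong suc eq₂)

-- Laplace along the first row: the two surviving terms cancel because the two minors coincide.
detℚ-adjacent-columns : ∀ n (M : Matrix n) {p q} → Adjacent p q → (∀ r → M r p ≡ M r q) → detℚ n M ≡ 0ℚ
detℚ-adjacent-columns (suc n) M {p} {q} adj Mₚ≡M_q = begin
  detℚ (suc n) M          ≡⟨ sum-pair (Adjacent⇒≢ adj) other-terms≡0 ⟩
  term p + term q         ≡⟨ cong₂ (λ s x → term p + s * x * detℚ n (minor M q)) (sgn-adjacent adj) (sym (Mₚ≡M_q zero)) ⟩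
  term p + (- sgn p) * M zero p * detℚ n (minor M q)
    ≡⟨ cong (λ d → term p + (- sgn p) * M zero p * d) (detℚ-cong n minors-equal) ⟩
  term p + (- sgn p) * M zero p * detℚ n (minor M p)
    ≡⟨ solve 3 (λ s m d → s :* m :* d :+ (:- s) :* m :* d := con 0ℚ) refl (sgn p) (M zero p) _ ⟩
  0ℚ                      ∎
  where
  term : Fin (suc n) → ℚ
  term j = sgn j * M zero j * detℚ n (minor M j)
  other-terms≡0 : ∀ j → j ≢ p → j ≢ q → term j ≡ 0ℚ
  other-terms≡0 j j≢p j≢q = trans
    (cong (sgn j * M zero j *_) (detℚ-adjacent-columns n (minor M j) (punchOut-adjacent adj j≢p j≢q) (λ r → begin
      M (suc r) (punchIn j (punchOut j≢p)) ≡⟨ cong (M (suc r)) (punchIn-punchOut j≢p) ⟩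
      M (suc r) p                          ≡⟨ Mₚ≡M_q (suc r) ⟩
      M (suc r) q                          ≡⟨ cong (M (suc r)) (sym (punchIn-punchOut j≢q)) ⟩
      M (suc r) (punchIn j (punchOut j≢q)) ∎)))
    (ℚP.*-zeroʳ (sgn j * M zero j))
  minors-equal : ∀ r c → minor M q r c ≡ minor M p r c
  minors-equal r c with punchIn-adjacent adj c
  ... | inj₁ eq          = cong (M (suc r)) (sym eq)
  ... | inj₂ (eq₁ , eq₂) = trans (cong (M (suc r)) eq₂) (trans (Mₚ≡M_q (suc r)) (cong (M (suc r)) (sym eq₁)))

column : ∀ {n} → Matrix n → Fin n → Fin n → ℚ
column M c r = M r c

replaceColumn : ∀ {n} → Matrix n → Fin n → (Fin n → ℚ) → Matrix n
replaceColumn M a v r c = if does (c ≟ a) then v r else M r c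

replaceColumn-at : ∀ {n} (M : Matrix n) a v r → replaceColumn M a v r a ≡ v r
replaceColumn-at M a v r = select-≡ a a refl

replaceColumn-off : ∀ {n} (M : Matrix n) {a} v r {c} → c ≢ a → replaceColumn M a v r c ≡ M r c
replaceColumn-off M {a} v r {c} c≢a = select-≢ c a c≢a

replaceColumn-self : ∀ {n} (M : Matrix n) a r c → replaceColumn M a (column M a) r c ≡ M r c
replaceColumn-self M a r c with c ≟ a
... | yes refl = refl
... | no _     = refl

detℚ-replaceColumn-linear : ∀ n (M : Matrix n) a k {w} u v → (∀ r → w r ≡ k * u r + v r) →
  detℚ n (replaceColumn M a w) ≡ k * detℚ n (replaceColumn M a u) + detℚ n (replaceColumn M a v)
detℚ-replaceColumn-linear n M a k {w} u v w≡ku+v = detℚ-linear n _ _ _ a k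
  (λ r c c≢a → trans (replaceColumn-off M w r c≢a) (sym (replaceColumn-off M u r c≢a)))
  (λ r c c≢a → trans (replaceColumn-off M w r c≢a) (sym (replaceColumn-off M v r c≢a)))
  (λ r → trans (replaceColumn-at M a w r)
    (trans (w≡ku+v r) (sym (cong₂ (λ x y → k * x + y) (replaceColumn-at M a u r) (replaceColumn-at M a v r)))))

detℚ-replaceColumn-+ : ∀ n (M : Matrix n) a u v →
  detℚ n (replaceColumn M a (λ r → u r + v r)) ≡ detℚ n (replaceColumn M a u) + detℚ n (replaceColumn M a v)
detℚ-replaceColumn-+ n M a u v = begin
  detℚ n (replaceColumn M a (λ r → u r + v r))
    ≡⟨ detℚ-replaceColumn-linear n M a 1ℚ u v (λ r → cong (_+ v r) (sym (ℚP.*-identityˡ (u r)))) ⟩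
  1ℚ * detℚ n (replaceColumn M a u) + detℚ n (replaceColumn M a v)
    ≡⟨ cong (_+ detℚ n (replaceColumn M a v)) (ℚP.*-identityˡ (detℚ n (replaceColumn M a u))) ⟩
  detℚ n (replaceColumn M a u) + detℚ n (replaceColumn M a v) ∎

replaceColumn-comm : ∀ {n} (M : Matrix n) {a b} → a ≢ b → ∀ x y r c →
  replaceColumn (replaceColumn M b y) a x r c ≡ replaceColumn (replaceColumn M a x) b y r c
replaceColumn-comm M {a} {b} a≢b x y r c with c ≟ a | c ≟ b
... | yes refl | yes refl = ⊥-elim (a≢b refl)
... | yes _    | no _     = refl
... | no _     | yes _    = refl
... | no _     | no _     = refl

-- An alternating bilinear form D changes sign under a transposition: expand D (u + v) (u + v) = 0.
detℚ-swap : ∀ n (M : Matrix n) {a b} → a ≢ b → (∀ X → (∀ r → X r a ≡ X r b) → detℚ n X ≡ 0ℚ) →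
  detℚ n (replaceColumn (replaceColumn M b (column M a)) a (column M b)) ≡ - detℚ n M
detℚ-swap n M {a} {b} a≢b alternating = begin
  D v u        ≡⟨ inverseʳ-unique (D u v) (D v u) D[u,v]+D[v,u]≡0 ⟩
  - D u v      ≡⟨ cong -_ (detℚ-cong n D[u,v]-entries) ⟩
  - detℚ n M   ∎
  where
  u v : Fin n → ℚ
  u = column M a
  v = column M b
  D : (Fin n → ℚ) → (Fin n → ℚ) → ℚ
  D x y = detℚ n (replaceColumn (replaceColumn M b y) a x)
  D[u,v]-entries : ∀ r c → replaceColumn (replaceColumn M b v) a u r c ≡ M r c
  D[u,v]-entries r c with c ≟ a
  ... | yes refl = refl
  ... | no _     = replaceColumn-self M b r c
  D-flipped : ∀ x y → D x y ≡ detℚ n (replaceColumn (replaceColumn M a x) b y)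
  D-flipped x y = detℚ-cong n (replaceColumn-comm M a≢b x y)
  additiveˡ : ∀ x x′ y → D (λ r → x r + x′ r) y ≡ D x y + D x′ y
  additiveˡ x x′ y = detℚ-replaceColumn-+ n (replaceColumn M b y) a x x′
  additiveʳ : ∀ x y y′ → D x (λ r → y r + y′ r) ≡ D x y + D x y′
  additiveʳ x y y′ = begin
    D x (λ r → y r + y′ r)                                         ≡⟨ D-flipped x _ ⟩
    detℚ n (replaceColumn (replaceColumn M a x) b (λ r → y r + y′ r)) ≡⟨ detℚ-replaceColumn-+ n (replaceColumn M a x) b y y′ ⟩
    detℚ n (replaceColumn (replaceColumn M a x) b y) + detℚ n (replaceColumn (replaceColumn M a x) b y′)
                                                                   ≡⟨ sym (cong₂ _+_ (D-flipped x y) (D-flipped x y′)) ⟩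
    D x y + D x y′                                                 ∎
  diagonal : ∀ x → D x x ≡ 0ℚ
  diagonal x = alternating X (λ r → trans (replaceColumn-at (replaceColumn M b x) a x r)
    (sym (trans (replaceColumn-off (replaceColumn M b x) x r (λ b≡a → a≢b (sym b≡a))) (replaceColumn-at M b x r))))
    where
    X : Matrix n
    X = replaceColumn (replaceColumn M b x) a x
  D[u,v]+D[v,u]≡0 : D u v + D v u ≡ 0ℚ
  D[u,v]+D[v,u]≡0 = sym (begin
    0ℚ                                  ≡⟨ sym (diagonal w) ⟩
    D w w                               ≡⟨ additiveˡ u v w ⟩
    D u w + D v w                       ≡⟨ cong₂ _+_ (additiveʳ u u v) (additiveʳ v u v) ⟩
    (D u u + D u v) + (D v u + D v v)   ≡⟨ cong₂ (λ p q → (p + D u v) + (D v u + q)) (diagonal u) (diagonal v) ⟩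
    (0ℚ + D u v) + (D v u + 0ℚ)         ≡⟨ solve 2 (λ p q → (con 0ℚ :+ p) :+ (q :+ con 0ℚ) := p :+ q) refl (D u v) (D v u) ⟩
    D u v + D v u                       ∎)
    where
    w : Fin n → ℚ
    w r = u r + v r

detℚ-equal-columns-at-distance : ∀ d {n} (M : Matrix (suc n)) p (x : Fin n) → toℕ x ≡ d ℕ.+ toℕ p →
  (∀ r → M r p ≡ M r (suc x)) → detℚ (suc n) M ≡ 0ℚ
detℚ-equal-columns-at-distance zero M p x x≡p Mₚ≡Mₓ =
  detℚ-adjacent-columns _ M (subst (λ p → Adjacent p (suc x)) (sym p≡x) (inject₁-adjacent x)) Mₚ≡Mₓ
  where
  p≡x : p ≡ inject₁ x
  p≡x = toℕ-injective (trans (sym x≡p) (sym (toℕ-inject₁ x)))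
detℚ-equal-columns-at-distance (suc d) {suc n} M p (suc x) x≡d+p Mₚ≡Mₓ = begin
  detℚ (suc (suc n)) M     ≡⟨ sym (⁻¹-involutive (detℚ (suc (suc n)) M)) ⟩
  - (- detℚ (suc (suc n)) M) ≡⟨ cong -_ (sym swapped≡-M) ⟩
  - detℚ (suc (suc n)) M′  ≡⟨ cong -_ M′≡0 ⟩
  0ℚ                       ∎
  where
  a b : Fin (suc (suc n))
  a = inject₁ (suc x)
  b = suc (suc x)
  adjacent : Adjacent a b
  adjacent = inject₁-adjacent (suc x)
  M′ : Matrix (suc (suc n))
  M′ = replaceColumn (replaceColumn M b (column M a)) a (column M b)
  swapped≡-M : detℚ (suc (suc n)) M′ ≡ - detℚ (suc (suc n)) M
  swapped≡-M = detℚ-swap _ M (Adjacent⇒≢ adjacent) (λ X → detℚ-adjacent-columns _ X adjacent)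
  x′≡d+p : toℕ (inject₁ x) ≡ d ℕ.+ toℕ p
  x′≡d+p = trans (toℕ-inject₁ x) (ℕP.suc-injective x≡d+p)
  p≢a : p ≢ a
  p≢a p≡a = ℕP.m≢1+n+m (toℕ p) (trans (cong toℕ p≡a) (cong suc x′≡d+p))
  p≢b : p ≢ b
  p≢b p≡b = ℕP.m≢1+n+m (toℕ p) {suc d} (trans (cong toℕ p≡b) (cong suc x≡d+p))
  M′≡0 : detℚ (suc (suc n)) M′ ≡ 0ℚ
  M′≡0 = detℚ-equal-columns-at-distance d M′ p (inject₁ x) x′≡d+p (λ r → begin
    M′ r p ≡⟨ replaceColumn-off (replaceColumn M b (column M a)) (column M b) r p≢a ⟩
    replaceColumn M b (column M a) r p ≡⟨ replaceColumn-off M (column M a) r p≢b ⟩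
    M r p  ≡⟨ Mₚ≡Mₓ r ⟩
    M r b  ≡⟨ sym (replaceColumn-at (replaceColumn M b (column M a)) a (column M b) r) ⟩
    M′ r a ∎)

detℚ-equal-columns-< : ∀ {n} (M : Matrix (suc n)) {p q} → toℕ p ℕ.< toℕ q →
  (∀ r → M r p ≡ M r q) → detℚ (suc n) M ≡ 0ℚ
detℚ-equal-columns-< M {p} {suc x} (ℕ.s≤s p≤x) =
  detℚ-equal-columns-at-distance (toℕ x ℕ.∸ toℕ p) M p x (sym (ℕP.m∸n+n≡m p≤x))

detℚ-equal-columns : ∀ n (M : Matrix n) {p q} → p ≢ q → (∀ r → M r p ≡ M r q) → detℚ n M ≡ 0ℚ
detℚ-equal-columns (suc n) M {p} {q} p≢q Mₚ≡M_q with ℕP.<-cmp (toℕ p) (toℕ q)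
... | tri< p<q _ _ = detℚ-equal-columns-< M p<q Mₚ≡M_q
... | tri≈ _ p≡q _ = ⊥-elim (p≢q (toℕ-injective p≡q))
... | tri> _ _ q<p = detℚ-equal-columns-< M q<p (λ r → sym (Mₚ≡M_q r))

detℚ-replaceColumn-combination : ∀ n k (M : Matrix n) a (W : Fin n → Fin k → ℚ) y →
  detℚ n (replaceColumn M a (W *ᵥ y)) ≡ sum (λ l → y l * detℚ n (replaceColumn M a (λ r → W r l)))
detℚ-replaceColumn-combination n zero    M a W y = detℚ-zero-column n _ a (replaceColumn-at M a (W *ᵥ y))
detℚ-replaceColumn-combination n (suc k) M a W y = begin
  detℚ n (replaceColumn M a (W *ᵥ y))
    ≡⟨ detℚ-replaceColumn-linear n M a (y zero) (λ r → W r zero) (W′ *ᵥ y′) (λ r → cong (_+ (W′ *ᵥ y′) r) (ℚP.*-comm (W r zero) (y zero))) ⟩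
  y zero * detℚ n (replaceColumn M a (λ r → W r zero)) + detℚ n (replaceColumn M a (W′ *ᵥ y′))
    ≡⟨ cong (y zero * detℚ n (replaceColumn M a (λ r → W r zero)) +_) (detℚ-replaceColumn-combination n k M a W′ y′) ⟩
  sum (λ l → y l * detℚ n (replaceColumn M a (λ r → W r l))) ∎
  where
  W′ : Fin n → Fin k → ℚ
  W′ r l = W r (suc l)
  y′ : Fin k → ℚ
  y′ l = y (suc l)

detℚ-replaceColumn-*ᵥ : ∀ n (M : Matrix n) a y → detℚ n (replaceColumn M a (M *ᵥ y)) ≡ y a * detℚ n M
detℚ-replaceColumn-*ᵥ n M a y = begin
  detℚ n (replaceColumn M a (M *ᵥ y))                          ≡⟨ detℚ-replaceColumn-combination n n M a M y ⟩
  sum (λ l → y l * detℚ n (replaceColumn M a (column M l)))    ≡⟨ sum-single a other-columns≡0 ⟩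
  y a * detℚ n (replaceColumn M a (column M a))                ≡⟨ cong (y a *_) (detℚ-cong n (replaceColumn-self M a)) ⟩
  y a * detℚ n M                                               ∎
  where
  other-columns≡0 : ∀ l → l ≢ a → y l * detℚ n (replaceColumn M a (column M l)) ≡ 0ℚ
  other-columns≡0 l l≢a = trans
    (cong (y l *_) (detℚ-equal-columns n _ (λ a≡l → l≢a (sym a≡l))
      (λ r → trans (replaceColumn-at M a (column M l) r) (sym (replaceColumn-off M (column M l) r l≢a)))))
    (ℚP.*-zeroʳ (y l))

detℚ-column-zero-below : ∀ n (M : Matrix (suc n)) a → (∀ r → M (suc r) a ≡ 0ℚ) →
  detℚ (suc n) M ≡ sgn a * M zero a * detℚ n (minor M a)
detℚ-column-zero-below n M a M≡0 = sum-single a (λ j j≢a → trans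
  (cong (sgn j * M zero j *_) (detℚ-zero-column n (minor M j) (punchOut j≢a)
    (λ r → trans (cong (M (suc r)) (punchIn-punchOut j≢a)) (M≡0 r))))
  (ℚP.*-zeroʳ (sgn j * M zero j)))

detℚ-row-zero-except : ∀ n (M : Matrix (suc n)) a → (∀ j → j ≢ a → M zero j ≡ 0ℚ) →
  detℚ (suc n) M ≡ sgn a * M zero a * detℚ n (minor M a)
detℚ-row-zero-except n M a M≡0 = sum-single a (λ j j≢a → begin
  sgn j * M zero j * detℚ n (minor M j) ≡⟨ cong (λ x → sgn j * x * detℚ n (minor M j)) (M≡0 j j≢a) ⟩
  sgn j * 0ℚ * detℚ n (minor M j)      ≡⟨ solve 2 (λ s d → s :* con 0ℚ :* d := con 0ℚ) refl (sgn j) (detℚ n (minor M j)) ⟩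
  0ℚ                                   ∎)

identity : ∀ {n} → Matrix n
identity r c = if does (r ≟ c) then 1ℚ else 0ℚ

detℚ-identity : ∀ n → detℚ n identity ≡ 1ℚ
detℚ-identity zero    = refl
detℚ-identity (suc n) = begin
  detℚ (suc n) identity                         ≡⟨ detℚ-row-zero-except n identity zero (λ j j≢0 → select-≢ zero j (λ 0≡j → j≢0 (sym 0≡j))) ⟩
  1ℚ * 1ℚ * detℚ n identity                     ≡⟨ cong (1ℚ * 1ℚ *_) (detℚ-identity n) ⟩
  1ℚ                                            ∎

-- Independent columns give a nonzero determinant

Independent : ∀ {k m} → (Fin k → Fin m → ℚ) → Set
Independent M = ∀ y → (∀ r → (M *ᵥ y) r ≡ 0ℚ) → ∀ j → y j ≡ 0ℚ

NontrivialKernel : ∀ {k m} → (Fin k → Fin m → ℚ) → Set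
NontrivialKernel {m = m} M = Σ[ y ∈ (Fin m → ℚ) ] Σ[ a ∈ Fin m ] y a ≢ 0ℚ × (∀ r → (M *ᵥ y) r ≡ 0ℚ)

-- Gaussian elimination on a pivot p of the first row: eliminate column p from the other rows,
-- solve the smaller system, and choose the p-th coordinate to satisfy the first row.
wide⇒nontrivialKernel : ∀ k m → k ℕ.< m → (M : Fin k → Fin m → ℚ) → NontrivialKernel M
wide⇒nontrivialKernel zero    (suc m) _           M = (λ _ → 1ℚ) , zero , ℚP.1≢0 , (λ ())
wide⇒nontrivialKernel (suc k) (suc m) (ℕ.s≤s k<m) M with all? (λ p → M zero p ℚP.≟ 0ℚ)
... | yes row₀≡0 = y , a , yₐ≢0 , rows≡0
  where
  lower = wide⇒nontrivialKernel k (suc m) (ℕP.m<n⇒m<1+n k<m) (λ r → M (suc r))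
  y = proj₁ lower
  a = proj₁ (proj₂ lower)
  yₐ≢0 = proj₁ (proj₂ (proj₂ lower))
  rows≡0 : ∀ r → (M *ᵥ y) r ≡ 0ℚ
  rows≡0 zero    = ∙-zeroˡ y row₀≡0
  rows≡0 (suc r) = proj₂ (proj₂ (proj₂ lower)) r
... | no row₀≢0 = y , punchIn p a′ , yₐ≢0 , rows≡0
  where
  pivot = ¬∀⟶∃¬ (suc m) (λ p → M zero p ≡ 0ℚ) (λ p → M zero p ℚP.≟ 0ℚ) row₀≢0
  p = proj₁ pivot
  π = M zero p
  π⁻¹ = (1/ π) {{ℚ.≢-nonZero (proj₂ pivot)}}
  ππ⁻¹≡1 : π * π⁻¹ ≡ 1ℚ
  ππ⁻¹≡1 = ℚP.*-inverseʳ π {{ℚ.≢-nonZero (proj₂ pivot)}}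
  W : Fin k → Fin m → ℚ
  W r c = removeAt (M (suc r)) p c - (M (suc r) p * π⁻¹) * removeAt (M zero) p c
  lower = wide⇒nontrivialKernel k m k<m W
  μ = proj₁ lower
  a′ = proj₁ (proj₂ lower)
  s = removeAt (M zero) p ∙ μ
  y = insertAt μ p (- (π⁻¹ * s))
  yₐ≢0 : y (punchIn p a′) ≢ 0ℚ
  yₐ≢0 yₐ≡0 = proj₁ (proj₂ (proj₂ lower)) (trans (sym (insertAt-punchIn μ p _ a′)) yₐ≡0)
  rows≡0 : ∀ r → (M *ᵥ y) r ≡ 0ℚ
  rows≡0 zero = begin
    M zero ∙ y                 ≡⟨ ∙-insertAt (M zero) μ p _ ⟩
    π * - (π⁻¹ * s) + s        ≡⟨ solve 3 (λ π i s → π :* :- (i :* s) :+ s := s :- (π :* i) :* s) refl π π⁻¹ s ⟩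
    s - (π * π⁻¹) * s          ≡⟨ cong (λ x → s - x * s) ππ⁻¹≡1 ⟩
    s - 1ℚ * s                 ≡⟨ solve 1 (λ s → s :- con 1ℚ :* s := con 0ℚ) refl s ⟩
    0ℚ                         ∎
  rows≡0 (suc r) = begin
    M (suc r) ∙ y              ≡⟨ ∙-insertAt (M (suc r)) μ p _ ⟩
    Q * - (π⁻¹ * s) + R        ≡⟨ solve 4 (λ Q i s R → Q :* :- (i :* s) :+ R := R :- (Q :* i) :* s) refl Q π⁻¹ s R ⟩
    R - (Q * π⁻¹) * s          ≡⟨ sym (∙-sub-scaledˡ (removeAt (M (suc r)) p) (removeAt (M zero) p) μ (Q * π⁻¹)) ⟩
    W r ∙ μ                    ≡⟨ proj₂ (proj₂ (proj₂ lower)) r ⟩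
    0ℚ                         ∎
    where
    Q = M (suc r) p
    R = removeAt (M (suc r)) p ∙ μ

-- If M κ = t e₀ with t ≠ 0 and κₐ ≠ 0, a kernel vector μ of the minor at a, padded with 0 at a,
-- is corrected by a multiple of κ to a kernel vector of M, whose a-th entry forces that multiple to be 0.
minor-independent : ∀ {n} (M : Matrix (suc n)) (κ : Fin (suc n) → ℚ) a → Independent M →
  (M *ᵥ κ) zero ≢ 0ℚ → (∀ r → (M *ᵥ κ) (suc r) ≡ 0ℚ) → κ a ≢ 0ℚ → Independent (minor M a)
minor-independent M κ a independent t≢0 lower≡0 κₐ≢0 μ minor-μ≡0 j = begin
  μ j                      ≡⟨ sym (insertAt-punchIn μ a 0ℚ j) ⟩
  μ̂ (punchIn a j)          ≡⟨ solve 3 (λ m c l → m := (m :- c :* l) :+ c :* l) refl (μ̂ (punchIn a j)) c (κ (punchIn a j)) ⟩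
  ν (punchIn a j) + c * κ (punchIn a j) ≡⟨ cong₂ (λ x y → x + y * κ (punchIn a j)) (ν≡0 (punchIn a j)) c≡0 ⟩
  0ℚ + 0ℚ * κ (punchIn a j) ≡⟨ solve 1 (λ l → con 0ℚ :+ con 0ℚ :* l := con 0ℚ) refl (κ (punchIn a j)) ⟩
  0ℚ                       ∎
  where
  μ̂ = insertAt μ a 0ℚ
  t = (M *ᵥ κ) zero
  t⁻¹ = (1/ t) {{ℚ.≢-nonZero t≢0}}
  s = M zero ∙ μ̂
  c = s * t⁻¹
  ν : Fin _ → ℚ
  ν j = μ̂ j - c * κ j
  Mν≡0 : ∀ r → (M *ᵥ ν) r ≡ 0ℚ
  Mν≡0 zero = begin
    M zero ∙ ν               ≡⟨ ∙-sub-scaledʳ (M zero) μ̂ κ c ⟩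
    s - s * t⁻¹ * t          ≡⟨ solve 3 (λ s i t → s :- s :* i :* t := s :- s :* (t :* i)) refl s t⁻¹ t ⟩
    s - s * (t * t⁻¹)        ≡⟨ cong (λ x → s - s * x) (ℚP.*-inverseʳ t {{ℚ.≢-nonZero t≢0}}) ⟩
    s - s * 1ℚ               ≡⟨ solve 1 (λ s → s :- s :* con 1ℚ := con 0ℚ) refl s ⟩
    0ℚ                       ∎
  Mν≡0 (suc r) = begin
    M (suc r) ∙ ν            ≡⟨ ∙-sub-scaledʳ (M (suc r)) μ̂ κ c ⟩
    M (suc r) ∙ μ̂ - c * (M (suc r) ∙ κ) ≡⟨ cong₂ (λ x y → x - c * y) (∙-insertAt (M (suc r)) μ a 0ℚ) (lower≡0 r) ⟩
    M (suc r) a * 0ℚ + minor M a r ∙ μ - c * 0ℚ ≡⟨ cong (λ x → M (suc r) a * 0ℚ + x - c * 0ℚ) (minor-μ≡0 r) ⟩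
    M (suc r) a * 0ℚ + 0ℚ - c * 0ℚ ≡⟨ solve 2 (λ m c → m :* con 0ℚ :+ con 0ℚ :- c :* con 0ℚ := con 0ℚ) refl (M (suc r) a) c ⟩
    0ℚ                       ∎
  ν≡0 = independent ν Mν≡0
  c≡0 : c ≡ 0ℚ
  c≡0 = *≡0⇒≡0 c (κ a) (begin
    c * κ a                 ≡⟨ solve 2 (λ c l → c :* l := :- (con 0ℚ :- c :* l)) refl c (κ a) ⟩
    - (0ℚ - c * κ a)        ≡⟨ cong (λ x → - (x - c * κ a)) (sym (insertAt-lookup μ a 0ℚ)) ⟩
    - ν a                    ≡⟨ cong -_ (ν≡0 a) ⟩
    0ℚ                       ∎) κₐ≢0

-- The lower rows have a kernel vector κ with κₐ ≠ 0, so M κ = t e₀ with t ≠ 0. Replacing column a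
-- by M κ multiplies the determinant by κₐ and leaves sgn a · t · det (minor M a), nonzero by induction.
independent⇒detℚ≢0 : ∀ n (M : Matrix n) → Independent M → detℚ n M ≢ 0ℚ
independent⇒detℚ≢0 zero    M _           = ℚP.1≢0
independent⇒detℚ≢0 (suc n) M independent detM≡0 = κₐdet≢0 (begin
  κ a * detℚ (suc n) M  ≡⟨ cong (κ a *_) detM≡0 ⟩
  κ a * 0ℚ              ≡⟨ ℚP.*-zeroʳ (κ a) ⟩
  0ℚ                     ∎)
  where
  lower = wide⇒nontrivialKernel n (suc n) (ℕP.n<1+n n) (λ r → M (suc r))
  κ = proj₁ lower
  a = proj₁ (proj₂ lower)
  κₐ≢0 = proj₁ (proj₂ (proj₂ lower))
  lower≡0 : ∀ r → (M *ᵥ κ) (suc r) ≡ 0ℚ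
  lower≡0 = proj₂ (proj₂ (proj₂ lower))
  t = (M *ᵥ κ) zero
  t≢0 : t ≢ 0ℚ
  t≢0 t≡0 = κₐ≢0 (independent κ (λ { zero → t≡0 ; (suc r) → lower≡0 r }) a)
  Y = replaceColumn M a (M *ᵥ κ)
  κₐdet≢0 : κ a * detℚ (suc n) M ≢ 0ℚ
  κₐdet≢0 = subst (_≢ 0ℚ) (begin
    sgn a * t * detℚ n (minor M a) ≡⟨ cong₂ (λ x d → sgn a * x * d) (sym (replaceColumn-at M a (M *ᵥ κ) zero))
                                        (detℚ-cong n (λ r c → sym (replaceColumn-off M (M *ᵥ κ) (suc r) (punchInᵢ≢i a c)))) ⟩
    sgn a * Y zero a * detℚ n (minor Y a) ≡⟨ sym (detℚ-column-zero-below n Y a (λ r → trans (replaceColumn-at M a (M *ᵥ κ) (suc r)) (lower≡0 r))) ⟩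
    detℚ (suc n) Y                        ≡⟨ detℚ-replaceColumn-*ᵥ (suc n) M a κ ⟩
    κ a * detℚ (suc n) M                 ∎)
    (*-≢0 (*-≢0 (sgn≢0 a) t≢0) (independent⇒detℚ≢0 n (minor M a) (minor-independent M κ a independent t≢0 lower≡0 κₐ≢0)))

-- Integers and rounding

coprime-1 : ∀ n → Coprimality.Coprime n 1
coprime-1 n = Coprimality.sym (Coprimality.1-coprimeTo n)

toℚ≡mkℚ : ∀ z → toℚ z ≡ mkℚ z 0 (coprime-1 ∣ z ∣)
toℚ≡mkℚ (ℤ.+ n)    = ℚP.normalize-coprime (coprime-1 n)
toℚ≡mkℚ ℤ.-[1+ n ] = cong -_ (ℚP.normalize-coprime (coprime-1 (suc n)))

toℚ-injective : ∀ {a b} → toℚ a ≡ toℚ b → a ≡ b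
toℚ-injective {a} {b} eq = cong ℚ.↥_ (trans (sym (toℚ≡mkℚ a)) (trans eq (toℚ≡mkℚ b)))

toℚ-homo-+ : ∀ a b → toℚ (a ℤ.+ b) ≡ toℚ a + toℚ b
toℚ-homo-+ a b = begin
  toℚ (a ℤ.+ b)                                        ≡⟨ cong toℚ (sym (cong₂ ℤ._+_ (ℤP.*-identityʳ a) (ℤP.*-identityʳ b))) ⟩
  toℚ (a ℤ.* ℤ.+ 1 ℤ.+ b ℤ.* ℤ.+ 1)                      ≡⟨⟩
  mkℚ a 0 (coprime-1 ∣ a ∣) + mkℚ b 0 (coprime-1 ∣ b ∣) ≡⟨ sym (cong₂ _+_ (toℚ≡mkℚ a) (toℚ≡mkℚ b)) ⟩
  toℚ a + toℚ b                                        ∎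

toℚ-homo-* : ∀ a b → toℚ (a ℤ.* b) ≡ toℚ a * toℚ b
toℚ-homo-* a b = sym (cong₂ _*_ (toℚ≡mkℚ a) (toℚ≡mkℚ b))

toℚ-homo-- : ∀ a → toℚ (ℤ.- a) ≡ - toℚ a
toℚ-homo-- a = trans (toℚ≡mkℚ (ℤ.- a)) (trans (mkℚ-neg a) (cong -_ (sym (toℚ≡mkℚ a))))
  where
  mkℚ-neg : ∀ a → mkℚ (ℤ.- a) 0 (coprime-1 ∣ ℤ.- a ∣) ≡ - mkℚ a 0 (coprime-1 ∣ a ∣)
  mkℚ-neg (ℤ.+ zero)  = refl
  mkℚ-neg (ℤ.+ suc n) = refl
  mkℚ-neg ℤ.-[1+ n ]  = refl

toℚ-homo-sumℤ : ∀ n (f : Fin n → ℤ) → toℚ (sumℤ n f) ≡ sum (λ j → toℚ (f j))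
toℚ-homo-sumℤ zero    f = refl
toℚ-homo-sumℤ (suc n) f = trans (toℚ-homo-+ (f zero) _) (cong (toℚ (f zero) +_) (toℚ-homo-sumℤ n (λ j → f (suc j))))

toℚ-mono-≤ : ∀ {a b} → a ℤ.≤ b → toℚ a ℚ.≤ toℚ b
toℚ-mono-≤ {a} {b} a≤b = subst₂ ℚ._≤_ (sym (toℚ≡mkℚ a)) (sym (toℚ≡mkℚ b))
  (ℚ.*≤* (subst₂ ℤ._≤_ (sym (ℤP.*-identityʳ a)) (sym (ℤP.*-identityʳ b)) a≤b))

toℚ-cancel-≤ : ∀ {a b} → toℚ a ℚ.≤ toℚ b → a ℤ.≤ b
toℚ-cancel-≤ {a} {b} a≤b with subst₂ ℚ._≤_ (toℚ≡mkℚ a) (toℚ≡mkℚ b) a≤b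
... | ℚ.*≤* a*1≤b*1 = subst₂ ℤ._≤_ (ℤP.*-identityʳ a) (ℤP.*-identityʳ b) a*1≤b*1

∣toℚ∣ : ∀ z → ℚ.∣ toℚ z ∣ ≡ toℚ (ℤ.+ ∣ z ∣)
∣toℚ∣ z = trans (cong ℚ.∣_∣ (toℚ≡mkℚ z)) (sym (toℚ≡mkℚ (ℤ.+ ∣ z ∣)))

toℚ-floor-≤ : ∀ q → toℚ (ℚ.floor q) ℚ.≤ q
toℚ-floor-≤ q@(mkℚ n d _) = subst (ℚ._≤ q) (sym (toℚ≡mkℚ (ℚ.floor q)))
  (ℚ.*≤* (subst (ℚ.floor q ℤ.* ℤ.+ suc d ℤ.≤_) (sym (ℤP.*-identityʳ n)) ([n/d]*d≤n n (ℤ.+ suc d))))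

<toℚ-floor+1 : ∀ q → q ℚ.< toℚ (ℚ.floor q ℤ.+ ℤ.+ 1)
<toℚ-floor+1 q@(mkℚ n d _) = subst (q ℚ.<_) (sym (toℚ≡mkℚ (⌊q⌋ ℤ.+ ℤ.+ 1)))
  (ℚ.*<* (subst₂ ℤ._<_ (sym (trans (ℤP.*-identityʳ n) (a≡a%n+[a/n]*n n D))) D+⌊q⌋D≡[⌊q⌋+1]D
    (ℤP.+-monoˡ-< (⌊q⌋ ℤ.* D) (ℤ.+<+ (n%d<d n D)))))
  where
  D = ℤ.+ suc d
  ⌊q⌋ = ℚ.floor q
  D+⌊q⌋D≡[⌊q⌋+1]D : D ℤ.+ ⌊q⌋ ℤ.* D ≡ (⌊q⌋ ℤ.+ ℤ.+ 1) ℤ.* D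
  D+⌊q⌋D≡[⌊q⌋+1]D = sym (begin
    (⌊q⌋ ℤ.+ ℤ.+ 1) ℤ.* D        ≡⟨ ℤP.*-distribʳ-+ D ⌊q⌋ (ℤ.+ 1) ⟩
    ⌊q⌋ ℤ.* D ℤ.+ ℤ.+ 1 ℤ.* D    ≡⟨ cong (λ z → ⌊q⌋ ℤ.* D ℤ.+ z) (ℤP.*-identityˡ D) ⟩
    ⌊q⌋ ℤ.* D ℤ.+ D             ≡⟨ ℤP.+-comm (⌊q⌋ ℤ.* D) D ⟩
    D ℤ.+ ⌊q⌋ ℤ.* D             ∎)

floor-toℚ : ∀ k → ℚ.floor (toℚ k) ≡ k
floor-toℚ k rewrite toℚ≡mkℚ k = sym (begin
  k                                       ≡⟨ a≡a%n+[a/n]*n k (ℤ.+ 1) ⟩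
  ℤ.+ (k % ℤ.+ 1) ℤ.+ (k / ℤ.+ 1) ℤ.* ℤ.+ 1 ≡⟨ cong (λ r → ℤ.+ r ℤ.+ (k / ℤ.+ 1) ℤ.* ℤ.+ 1) (ℕP.n<1⇒n≡0 (n%d<d k (ℤ.+ 1))) ⟩
  ℤ.+ 0 ℤ.+ (k / ℤ.+ 1) ℤ.* ℤ.+ 1          ≡⟨ trans (ℤP.+-identityˡ _) (ℤP.*-identityʳ _) ⟩
  k / ℤ.+ 1                               ∎)

nearest-error-bounds : ∀ x → (- ½ ℚ.≤ x - toℚ (nearest x)) × (x - toℚ (nearest x) ℚ.< ½)
nearest-error-bounds x = lower , upper
  where
  k = toℚ (nearest x)
  lower : - ½ ℚ.≤ x - k
  lower = subst₂ ℚ._≤_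
    (solve 1 (λ k → k :+ (:- k :- con ½) := :- con ½) refl k)
    (solve 2 (λ x k → (x :+ con ½) :+ (:- k :- con ½) := x :- k) refl x k)
    (ℚP.+-monoˡ-≤ (- k - ½) (toℚ-floor-≤ (x + ½)))
  upper : x - k ℚ.< ½
  upper = subst₂ ℚ._<_
    (solve 2 (λ x k → (x :+ con ½) :+ (:- k :- con ½) := x :- k) refl x k)
    (solve 1 (λ k → (k :+ con 1ℚ) :+ (:- k :- con ½) := con ½) refl k)
    (ℚP.+-monoˡ-< (- k - ½) (subst (x + ½ ℚ.<_) (toℚ-homo-+ (nearest x) (ℤ.+ 1)) (<toℚ-floor+1 (x + ½))))

∣x-nearest∣≤½ : ∀ x → ℚ.∣ x - toℚ (nearest x) ∣ ℚ.≤ ½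
∣x-nearest∣≤½ x with ℚP.∣p∣≡p∨∣p∣≡-p (x - toℚ (nearest x))
... | inj₁ ∣y∣≡y  = subst (ℚ._≤ ½) (sym ∣y∣≡y) (ℚP.<⇒≤ (proj₂ (nearest-error-bounds x)))
... | inj₂ ∣y∣≡-y = subst₂ ℚ._≤_ (sym ∣y∣≡-y) (⁻¹-involutive ½) (ℚP.neg-antimono-≤ (proj₁ (nearest-error-bounds x)))

frac≢0⇒x-nearest≢0 : ∀ x → ¬ frac x ≡ 0ℚ → x - toℚ (nearest x) ≢ 0ℚ
frac≢0⇒x-nearest≢0 x frac≢0 x-k≡0 = frac≢0 (begin
  x - toℚ (ℚ.floor x) ≡⟨ cong (λ z → z - toℚ (ℚ.floor z)) x≡k ⟩
  k - toℚ (ℚ.floor k) ≡⟨ cong (λ z → k - toℚ z) (floor-toℚ (nearest x)) ⟩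
  k - k               ≡⟨ ℚP.+-inverseʳ k ⟩
  0ℚ                  ∎)
  where
  k = toℚ (nearest x)
  x≡k : x ≡ k
  x≡k = begin
    x           ≡⟨ solve 2 (λ x k → x := (x :- k) :+ k) refl x k ⟩
    (x - k) + k ≡⟨ cong (_+ k) x-k≡0 ⟩
    0ℚ + k      ≡⟨ ℚP.+-identityˡ k ⟩
    k           ∎

-- The determinant detM agrees with detℚ

toℚᴹ : ∀ {n} → (Fin n → Fin n → ℤ) → Matrix n
toℚᴹ M r c = toℚ (M r c)

DetAgrees : ℕ → Set
DetAgrees n = ∀ M → toℚ (detM n M) ≡ detℚ n (toℚᴹ M)

private
  tailOf : ∀ {n} (x : ℤ) {f : Fin n → ℤ} → x ℤ.+ sumℤ n f ≡ x ℤ.+ sumℤ n f → Fin n → ℤ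
  tailOf _ {f} _ = f

-- The sign function of detM is local to its definition and cannot be named; the Laplace terms
-- after the first are captured here by unification instead.
laplaceTail : ∀ n → (Fin (suc n) → Fin (suc n) → ℤ) → Fin n → ℤ
laplaceTail n M = tailOf (ℤ.+ 1 ℤ.* M zero zero ℤ.* detM n (minor M zero)) (refl {x = detM (suc n) M})

detM-suc : ∀ n M → detM (suc n) M ≡ ℤ.+ 1 ℤ.* M zero zero ℤ.* detM n (minor M zero) ℤ.+ sumℤ n (laplaceTail n M)
detM-suc n M = refl

-- Its first row is constant x and its minor at column suc j is diag(y, 1, …, 1).
probe : ∀ m → ℤ → ℤ → Fin (suc m) → Fin (suc (suc m)) → Fin (suc (suc m)) → ℤ
probe m x y j zero          _       = x
probe m x y j (suc zero)    zero    = y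
probe m x y j (suc zero)    (suc _) = ℤ.+ 0
probe m x y j (suc (suc r)) zero    = ℤ.+ 0
probe m x y j (suc (suc r)) (suc c) = if does (c ≟ punchIn j r) then ℤ.+ 1 else ℤ.+ 0

detM-probe-minor : ∀ m x y j → DetAgrees (suc m) → detM (suc m) (minor (probe m x y j) (suc j)) ≡ y
detM-probe-minor m x y j agrees = toℚ-injective (begin
  toℚ (detM (suc m) (minor (probe m x y j) (suc j))) ≡⟨ agrees (minor (probe m x y j) (suc j)) ⟩
  detℚ (suc m) Q                                     ≡⟨ detℚ-row-zero-except m Q zero row₀ ⟩
  1ℚ * toℚ y * detℚ m (minor Q zero)                 ≡⟨ cong (1ℚ * toℚ y *_) (trans (detℚ-cong m minor≡identity) (detℚ-identity m)) ⟩
  1ℚ * toℚ y * 1ℚ                                    ≡⟨ solve 1 (λ y → con 1ℚ :* y :* con 1ℚ := y) refl (toℚ y) ⟩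
  toℚ y                                              ∎)
  where
  Q = toℚᴹ (minor (probe m x y j) (suc j))
  row₀ : ∀ c → c ≢ zero → Q zero c ≡ 0ℚ
  row₀ zero    c≢0 = ⊥-elim (c≢0 refl)
  row₀ (suc c) c≢0 = refl
  minor≡identity : ∀ r c → minor Q zero r c ≡ identity r c
  minor≡identity r c with r ≟ c
  ... | yes refl = cong toℚ (select-≡ (punchIn j r) (punchIn j r) refl)
  ... | no r≢c   = cong toℚ (select-≢ (punchIn j c) (punchIn j r) (λ eq → r≢c (sym (punchIn-injective j c r eq))))

-- The term at suc (suc j) carries the same local sign as the term at j of any matrix two sizes
-- smaller, since that sign ignores the matrix; a probe with the same entry and minor determinant
-- transfers the claim from the smaller size.
laplaceTail-sign : ∀ n → (∀ {k} → k ℕ.< n → DetAgrees k) → ∀ M j →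
  toℚ (laplaceTail n M j) ≡ sgn (suc j) * toℚ (M zero (suc j)) * toℚ (detM n (minor M (suc j)))
laplaceTail-sign (suc n) agrees M zero = begin
  toℚ (ℤ.- ℤ.+ 1 ℤ.* M zero (suc zero) ℤ.* d)          ≡⟨ toℚ-homo-* (ℤ.- ℤ.+ 1 ℤ.* M zero (suc zero)) d ⟩
  toℚ (ℤ.- ℤ.+ 1 ℤ.* M zero (suc zero)) * toℚ d        ≡⟨ cong (_* toℚ d) (toℚ-homo-* (ℤ.- ℤ.+ 1) (M zero (suc zero))) ⟩
  - 1ℚ * toℚ (M zero (suc zero)) * toℚ d               ∎
  where d = detM (suc n) (minor M (suc zero))
laplaceTail-sign (suc (suc n)) agrees M (suc zero) = begin
  toℚ (ℤ.+ 1 ℤ.* M zero (suc (suc zero)) ℤ.* d)        ≡⟨ toℚ-homo-* (ℤ.+ 1 ℤ.* M zero (suc (suc zero))) d ⟩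
  toℚ (ℤ.+ 1 ℤ.* M zero (suc (suc zero))) * toℚ d      ≡⟨ cong (_* toℚ d) (toℚ-homo-* (ℤ.+ 1) (M zero (suc (suc zero)))) ⟩
  1ℚ * toℚ (M zero (suc (suc zero))) * toℚ d           ∎
  where d = detM (suc (suc n)) (minor M (suc (suc zero)))
laplaceTail-sign (suc (suc (suc m))) agrees M (suc (suc j))
  with M zero (suc (suc (suc j))) | detM (suc (suc (suc m))) (minor M (suc (suc (suc j))))
... | x | y rewrite sym (detM-probe-minor m x y j (agrees (ℕP.m<n+m (suc m) {2} ℕ.z<s))) = begin
  toℚ (laplaceTail (suc m) (probe m x y j) j)   ≡⟨ laplaceTail-sign (suc m) (λ k<1+m → agrees (ℕP.m<n⇒m<1+n (ℕP.m<n⇒m<1+n k<1+m))) (probe m x y j) j ⟩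
  - sgn j * toℚ x * toℚ d                       ≡⟨ cong (λ s → s * toℚ x * toℚ d) (sym (⁻¹-involutive (- sgn j))) ⟩
  - (- (- sgn j)) * toℚ x * toℚ d               ∎
  where
  d = detM (suc m) (minor (probe m x y j) (suc j))

detM-agrees : ∀ n → DetAgrees n
detM-agrees = <-rec DetAgrees agrees
  where
  agrees : ∀ n → (∀ {k} → k ℕ.< n → DetAgrees k) → DetAgrees n
  agrees zero    _       M = refl
  agrees (suc n) smaller M = begin
    toℚ (detM (suc n) M)                                     ≡⟨ cong toℚ (detM-suc n M) ⟩
    toℚ (first ℤ.+ sumℤ n (laplaceTail n M))                 ≡⟨ toℚ-homo-+ first (sumℤ n (laplaceTail n M)) ⟩
    toℚ first + toℚ (sumℤ n (laplaceTail n M))               ≡⟨ cong₂ _+_ first-agrees (trans (toℚ-homo-sumℤ n (laplaceTail n M)) (sum-cong-≗ tail-agrees)) ⟩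
    detℚ (suc n) (toℚᴹ M)                                    ∎
    where
    first = ℤ.+ 1 ℤ.* M zero zero ℤ.* detM n (minor M zero)
    minor-agrees : ∀ j → toℚ (detM n (minor M j)) ≡ detℚ n (minor (toℚᴹ M) j)
    minor-agrees j = smaller (ℕP.n<1+n n) (minor M j)
    first-agrees : toℚ first ≡ 1ℚ * toℚ (M zero zero) * detℚ n (minor (toℚᴹ M) zero)
    first-agrees = begin
      toℚ first                                             ≡⟨ toℚ-homo-* (ℤ.+ 1 ℤ.* M zero zero) (detM n (minor M zero)) ⟩
      toℚ (ℤ.+ 1 ℤ.* M zero zero) * toℚ (detM n (minor M zero)) ≡⟨ cong₂ _*_ (toℚ-homo-* (ℤ.+ 1) (M zero zero)) (minor-agrees zero) ⟩
      1ℚ * toℚ (M zero zero) * detℚ n (minor (toℚᴹ M) zero) ∎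
    tail-agrees : ∀ j → toℚ (laplaceTail n M j) ≡ sgn (suc j) * toℚ (M zero (suc j)) * detℚ n (minor (toℚᴹ M) (suc j))
    tail-agrees j = trans (laplaceTail-sign n (λ k<n → smaller (ℕP.m<n⇒m<1+n k<n)) M j)
      (cong (sgn (suc j) * toℚ (M zero (suc j)) *_) (minor-agrees (suc j)))

-- Exchange steps

colsℚ : ∀ {n} → Cols n → Matrix n
colsℚ B r j = toℚ (B j r)

toℚ-det : ∀ {n} (B : Cols n) → toℚ (det B) ≡ detℚ n (colsℚ B)
toℚ-det {n} B = detM-agrees n (λ i j → B j i)

LinIndep⇒det≢0 : ∀ {n} (B : Cols n) → LinIndep B → det B ≢ ℤ.+ 0
LinIndep⇒det≢0 {n} B linIndep det≡0 = independent⇒detℚ≢0 n (colsℚ B) independent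
  (trans (sym (toℚ-det B)) (cong toℚ det≡0))
  where
  independent : Independent (colsℚ B)
  independent y By≡0 = linIndep y (λ r → begin
    sumℚ n (λ j → y j * toℚ (B j r)) ≡⟨ sumℚ≡sum n _ ⟩
    sum (λ j → y j * toℚ (B j r))    ≡⟨ sum-cong-≗ (λ j → ℚP.*-comm (y j) (toℚ (B j r))) ⟩
    colsℚ B r ∙ y                    ≡⟨ By≡0 r ⟩
    0ℚ                               ∎)

-- The new column is B (x - z), where z is the rounding of x used by newColumn.
exchange-det : ∀ {n} (B : Cols n) c x i → Solves B x c →
  toℚ (det (replaceCol B i (newColumn B c x i))) ≡ (x i - toℚ (nearest (x i))) * toℚ (det B)
exchange-det {n} B c x i solves = begin
  toℚ (det (replaceCol B i (newColumn B c x i)))         ≡⟨ toℚ-det (replaceCol B i (newColumn B c x i)) ⟩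
  detℚ n (colsℚ (replaceCol B i (newColumn B c x i)))    ≡⟨ detℚ-cong n entries ⟩
  detℚ n (replaceColumn (colsℚ B) i (colsℚ B *ᵥ y))      ≡⟨ detℚ-replaceColumn-*ᵥ n (colsℚ B) i y ⟩
  y i * detℚ n (colsℚ B)                                 ≡⟨ cong₂ _*_ (cong (λ k → x i - toℚ k) (select-≡ i i refl)) (sym (toℚ-det B)) ⟩
  (x i - toℚ (nearest (x i))) * toℚ (det B)              ∎
  where
  z : Fin n → ℤ
  z j = if does (j ≟ i) then nearest (x j) else ℚ.floor (x j)
  y : Fin n → ℚ
  y j = x j - toℚ (z j)
  new≡By : ∀ r → toℚ (newColumn B c x i r) ≡ (colsℚ B *ᵥ y) r
  new≡By r = begin
    toℚ (c r ℤ.- sumℤ n (λ j → B j r ℤ.* z j))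
      ≡⟨ trans (toℚ-homo-+ (c r) _) (cong (toℚ (c r) +_) (toℚ-homo-- (sumℤ n (λ j → B j r ℤ.* z j)))) ⟩
    toℚ (c r) - toℚ (sumℤ n (λ j → B j r ℤ.* z j))
      ≡⟨ cong₂ _-_ (trans (sym (solves r)) (sumℚ≡sum n _))
                   (trans (toℚ-homo-sumℤ n _) (sum-cong-≗ (λ j → toℚ-homo-* (B j r) (z j)))) ⟩
    colsℚ B r ∙ x - colsℚ B r ∙ (λ j → toℚ (z j))
      ≡⟨ sym (∙-subʳ (colsℚ B r) x (λ j → toℚ (z j))) ⟩
    colsℚ B r ∙ y ∎
  entries : ∀ r j → colsℚ (replaceCol B i (newColumn B c x i)) r j ≡ replaceColumn (colsℚ B) i (colsℚ B *ᵥ y) r j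
  entries r j with j ≟ i
  ... | yes _ = new≡By r
  ... | no _  = refl

scaled-≤½⇒2∣a∣≤∣b∣ : ∀ (a b : ℤ) y → toℚ a ≡ y * toℚ b → ℚ.∣ y ∣ ℚ.≤ ½ → 2 ℕ.* ∣ a ∣ ℕ.≤ ∣ b ∣
scaled-≤½⇒2∣a∣≤∣b∣ a b y a≡yb ∣y∣≤½ = ℤP.drop‿+≤+ (toℚ-cancel-≤ (subst₂ ℚ._≤_ 2∣a∣ (∣toℚ∣ b) 2∣a∣≤∣b∣))
  where
  two = toℚ (ℤ.+ 2)
  instance
    two-nonNeg : ℚ.NonNegative two
    two-nonNeg = ℚ.nonNegative {two} (toℚ-mono-≤ {ℤ.+ 0} {ℤ.+ 2} (ℤ.+≤+ ℕ.z≤n))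
  ∣a∣≤½∣b∣ : ℚ.∣ toℚ a ∣ ℚ.≤ ½ * ℚ.∣ toℚ b ∣
  ∣a∣≤½∣b∣ = subst (ℚ._≤ ½ * ℚ.∣ toℚ b ∣) (sym (trans (cong ℚ.∣_∣ a≡yb) (ℚP.∣p*q∣≡∣p∣*∣q∣ y (toℚ b))))
    (ℚP.*-monoʳ-≤-nonNeg ℚ.∣ toℚ b ∣ {{ℚP.∣-∣-nonNeg (toℚ b)}} ∣y∣≤½)
  2∣a∣≤∣b∣ : two * ℚ.∣ toℚ a ∣ ℚ.≤ ℚ.∣ toℚ b ∣
  2∣a∣≤∣b∣ = subst (two * ℚ.∣ toℚ a ∣ ℚ.≤_) (solve 1 (λ q → con two :* (con ½ :* q) := q) refl ℚ.∣ toℚ b ∣)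
    (ℚP.*-monoˡ-≤-nonNeg two ∣a∣≤½∣b∣)
  2∣a∣ : two * ℚ.∣ toℚ a ∣ ≡ toℚ (ℤ.+ (2 ℕ.* ∣ a ∣))
  2∣a∣ = begin
    two * ℚ.∣ toℚ a ∣           ≡⟨ cong (two *_) (∣toℚ∣ a) ⟩
    two * toℚ (ℤ.+ ∣ a ∣)       ≡⟨ sym (toℚ-homo-* (ℤ.+ 2) (ℤ.+ ∣ a ∣)) ⟩
    toℚ (ℤ.+ 2 ℤ.* ℤ.+ ∣ a ∣)   ≡⟨ cong toℚ (sym (ℤP.pos-* 2 ∣ a ∣)) ⟩
    toℚ (ℤ.+ (2 ℕ.* ∣ a ∣))     ∎

scaled-≢0 : ∀ (a b : ℤ) y → toℚ a ≡ y * toℚ b → y ≢ 0ℚ → b ≢ ℤ.+ 0 → a ≢ ℤ.+ 0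
scaled-≢0 a b y a≡yb y≢0 b≢0 a≡0 =
  y≢0 (*≡0⇒≡0 y (toℚ b) (trans (sym a≡yb) (cong toℚ a≡0)) (λ b≡0 → b≢0 (toℚ-injective b≡0)))

step-det : ∀ {n} {s t : State n} {e} → Step s t e → det (State.Bs s) ≢ ℤ.+ 0 →
  det (State.Bs t) ≢ ℤ.+ 0 × 2 ℕ.^ e ℕ.* ∣ det (State.Bs t) ∣ ℕ.≤ ∣ det (State.Bs s) ∣
step-det (keep B C₁ c C₂ x _ _) det≢0 = det≢0 , ℕP.≤-reflexive (ℕP.*-identityˡ ∣ det B ∣)
step-det (exchange B C₁ c C₂ x i solves frac≢0) det≢0 =
  scaled-≢0 det′ (det B) yᵢ (exchange-det B c x i solves) (frac≢0⇒x-nearest≢0 (x i) frac≢0) det≢0 ,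
  scaled-≤½⇒2∣a∣≤∣b∣ det′ (det B) yᵢ (exchange-det B c x i solves) (∣x-nearest∣≤½ (x i))
  where
  det′ = det (replaceCol B i (newColumn B c x i))
  yᵢ = x i - toℚ (nearest (x i))

run-det : ∀ {n} {s t : State n} {k} → Run s t k → det (State.Bs s) ≢ ℤ.+ 0 → 2 ℕ.^ k ℕ.≤ ∣ det (State.Bs s) ∣
run-det (done s) det≢0 = ℕP.n≢0⇒n>0 (λ ∣det∣≡0 → det≢0 (ℤP.∣i∣≡0⇒i≡0 ∣det∣≡0))
run-det (step {e = e} {k = k} st run) det≢0 = ℕP.≤-trans (ℕP.≤-reflexive (ℕP.^-distribˡ-+-* 2 e k))
  (ℕP.≤-trans (ℕP.*-monoʳ-≤ (2 ℕ.^ e) (run-det run (proj₁ (step-det st det≢0)))) (proj₂ (step-det st det≢0)))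

mainTheorem2 : (n m : ℕ) (A : Fin m → Vecℤ n) (σ : Fin n → Fin m) →
  (∀ j j′ → σ j ≡ σ j′ → j ≡ j′) →
  LinIndep (λ j → A (σ j)) →
  (t : State n) (k : ℕ) →
  Run ⟨ (λ j → A (σ j)) , remaining A σ ⟩ t k →
  k ≤ ⌊log₂ ∣ det (λ j → A (σ j)) ∣ ⌋
mainTheorem2 n m A σ _ linIndep t k run =
  subst (ℕ._≤ ⌊log₂ ∣ det B ∣ ⌋) (⌊log₂[2^n]⌋≡n k) (⌊log₂⌋-mono-≤ (run-det run (LinIndep⇒det≢0 B linIndep)))
  where
  B : Cols n
  B j = A (σ j)
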